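{- For all $n\in\mathbb{N}$, $k\in[n]$ and $\mathbf{x}\in\{0,1\}^n$, the $k$-th partial derivative of $F_n$ at $\mathbf{x}$ is $$\partial_kF_n(\mathbf{x})=(1-2\alpha_{n,k+1}(\mathbf{x}))\sum_{i=1}^k2^{i-1}\prod_{j=i}^{k-1}(1-2x_j)\;-\;2^k(1-2x_k)\Bigl(1-x_{k-1}+\sum_{i=1}^{k-2}x_i\Bigr),$$ where $x_0:=1$ (so in particular $\partial_1F_n(\mathbf{x})=1-2\alpha_{n,2}(\mathbf{x})$), empty sums are $0$ and empty products are $1$.
   Context: For $n\in\mathbb{N}$ and $\mathbf{x}=(x_1,\dots,x_n)^\top\in\mathbb{R}^n$, set $x_0:=1$, $\alpha_{n,n+1}(\mathbf{x})=0$, and for $i\in[n]=\{1,\dots,n\}$: $\alpha_{n,i}(\mathbf{x})=x_i+(1-2x_i)\alpha_{n,i+1}(\mathbf{x})$ and $\beta_{n,i}(\mathbf{x})=2^i(x_i-x_i^2)\bigl(1-x_{i-1}+\sum_{j=1}^{i-2}x_j\bigr)$. Define $F_n(\mathbf{x})=\sum_{i=1}^n\bigl(2^{i-1}\alpha_{n,i}(\mathbf{x})-\beta_{n,i}(\mathbf{x})\bigr)$, a polynomial in $x_1,\dots,x_n$. -}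

module Defs where

open import Data.Nat using (ℕ; zero; suc; _∸_; _<?_) renaming (_+_ to _+ℕ_; _^_ to _^ℕ_)
open import Data.Fin using (Fin; fromℕ<; toℕ)
open import Data.Fin.Properties using (_≟_)
open import Data.Bool using (Bool; true; false)
open import Data.Integer using (ℤ; +_; _+_; _*_; _-_; -_)
open import Data.List using (List; []; _∷_; map; foldr; applyUpTo)
open import Relation.Nullary using (yes; no)

-- Formal polynomial expressions in the n variables x₁,…,xₙ (variable xᵢ is
-- represented by the index i-1 : Fin n), with integer coefficients.
data Poly (n : ℕ) : Set where
  const : ℤ → Poly n
  var   : Fin n → Poly n
  _⊕_   : Poly n → Poly n → Poly n
  _⊗_   : Poly n → Poly n → Poly n

infixl 6 _⊕_ _⊖_
infixl 7 _⊗_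

_⊖_ : ∀ {n} → Poly n → Poly n → Poly n
p ⊖ q = p ⊕ (const (- (+ 1)) ⊗ q)

eval : ∀ {n} → (Fin n → ℤ) → Poly n → ℤ
eval x (const c) = c
eval x (var i)   = x i
eval x (p ⊕ q)   = eval x p + eval x q
eval x (p ⊗ q)   = eval x p * eval x q

∂ : ∀ {n} → Fin n → Poly n → Poly n
∂ k (const c) = const (+ 0)
∂ k (var i) with k ≟ i
... | yes _ = const (+ 1)
... | no  _ = const (+ 0)
∂ k (p ⊕ q) = ∂ k p ⊕ ∂ k q
∂ k (p ⊗ q) = (∂ k p ⊗ q) ⊕ (p ⊗ ∂ k q)

-- indices a, a+1, …, b  (empty if b < a)
range : ℕ → ℕ → List ℕ
range a b = applyUpTo (a +ℕ_) (suc b ∸ a)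

sumP : ∀ {n} → List ℕ → (ℕ → Poly n) → Poly n
sumP is f = foldr (λ i acc → f i ⊕ acc) (const (+ 0)) is

-- the polynomial xᵢ, with x₀ := 1 (indices > n never occur below)
X : ∀ {n} → ℕ → Poly n
X zero = const (+ 1)
X {n} (suc i) with i <? n
... | yes p = var (fromℕ< p)
... | no  _ = const (+ 0)

one two : ∀ {n} → Poly n
one = const (+ 1)
two = const (+ 2)

pow2 : ∀ {n} → ℕ → Poly n
pow2 i = const (+ (2 ^ℕ i))

-- αFrom m = α_{n, n+1-m}; α_{n,n+1} = 0, α_{n,i} = xᵢ + (1-2xᵢ) α_{n,i+1}
αFrom : ∀ {n} → ℕ → Poly n
αFrom zero = const (+ 0)
αFrom {n} (suc m) = X (n ∸ m) ⊕ ((one ⊖ (two ⊗ X (n ∸ m))) ⊗ αFrom m)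

α : (n : ℕ) → ℕ → Poly n
α n i = αFrom (suc n ∸ i)

β : (n : ℕ) → ℕ → Poly n
β n i = pow2 i ⊗ (X i ⊖ (X i ⊗ X i))
          ⊗ ((one ⊖ X (i ∸ 1)) ⊕ sumP (range 1 (i ∸ 2)) X)

F : (n : ℕ) → Poly n
F n = sumP (range 1 n) (λ i → (pow2 (i ∸ 1) ⊗ α n i) ⊖ β n i)

toℤ : Bool → ℤ
toℤ true  = + 1
toℤ false = + 0

pt : ∀ {n} → (Fin n → Bool) → Fin n → ℤ
pt x i = toℤ (x i)

sumℤ : List ℕ → (ℕ → ℤ) → ℤ
sumℤ is f = foldr (λ i acc → f i + acc) (+ 0) is

prodℤ : List ℕ → (ℕ → ℤ) → ℤ
prodℤ is f = foldr (λ i acc → f i * acc) (+ 1) is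

rhs : (n : ℕ) → (Fin n → Bool) → ℕ → ℤ
rhs n x k =
  ((+ 1 - (+ 2) * ev (α n (suc k)))
     * sumℤ (range 1 k) (λ i → + (2 ^ℕ (i ∸ 1))
           * prodℤ (range i (k ∸ 1)) (λ j → + 1 - (+ 2) * xv j)))
  - (+ (2 ^ℕ k)) * (+ 1 - (+ 2) * xv k)
      * ((+ 1 - xv (k ∸ 1)) + sumℤ (range 1 (k ∸ 2)) xv)
  where
  ev : Poly n → ℤ
  ev = eval (pt x)
  xv : ℕ → ℤ
  xv j = ev (X j)

{-# OPTIONS --safe #-}

-- At a point of {0,1}ⁿ the factor xᵢ − xᵢ² of βₙ,ᵢ vanishes, so by the product rule only its
-- derivative (1 − 2xᵢ)∂ₖxᵢ survives: ∂ₖβₙ,ᵢ is 0 for i ≠ k and is the second term of the formula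
-- for i = k. Differentiating αₙ,ᵢ = xᵢ + (1 − 2xᵢ)αₙ,ᵢ₊₁ (at any point) gives ∂ₖαₙ,ᵢ = 0 for i > k,
-- ∂ₖαₙ,ₖ = 1 − 2αₙ,ₖ₊₁ and ∂ₖαₙ,ᵢ = (1 − 2xᵢ)∂ₖαₙ,ᵢ₊₁ for i < k, so that
-- ∂ₖαₙ,ᵢ = (1 − 2αₙ,ₖ₊₁)∏_{j=i}^{k−1}(1 − 2xⱼ) for i ≤ k; weighting by 2^{i−1} and summing
-- gives the first term.

module Submission where

open import Defs
open import Data.Nat as ℕ using (ℕ; zero; suc; _≤_; _<_; _∸_; _^_; _<?_)
import Data.Nat.Properties as ℕₚ
open import Data.Fin using (Fin; toℕ; fromℕ<)
open import Data.Fin.Properties using (_≟_; toℕ-fromℕ<; fromℕ<-toℕ; toℕ<n)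
open import Data.Bool using (Bool; true; false)
open import Data.Integer using (ℤ; +_; _+_; _*_; _-_; -_)
open import Data.Integer.Properties
  using (+-identityˡ; +-identityʳ; +-assoc; *-zeroʳ; *-identityˡ; *-commutativeSemigroup)
open import Algebra.Properties.CommutativeSemigroup *-commutativeSemigroup using (x∙yz≈y∙xz)
open import Data.Integer.Tactic.RingSolver using (solve-∀)
open import Data.List using ([]; _∷_; applyUpTo; upTo)
open import Data.List.Properties using (map-upTo; map-cong)
open import Data.Empty using (⊥-elim)
open import Function using (_∘_)
open import Relation.Binary.PropositionalEquality
  using (_≡_; _≢_; _≗_; refl; sym; trans; cong; cong₂; module ≡-Reasoning)
open import Relation.Nullary using (yes; no)

open ≡-Reasoning

sumℤ-cong : ∀ l {f g : ℕ → ℤ} → f ≗ g → sumℤ l f ≡ sumℤ l g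
sumℤ-cong []      f≗g = refl
sumℤ-cong (i ∷ l) f≗g = cong₂ _+_ (f≗g i) (sumℤ-cong l f≗g)

sumℤ-− : ∀ l (f g : ℕ → ℤ) → sumℤ l (λ i → f i - g i) ≡ sumℤ l f - sumℤ l g
sumℤ-− []      f g = refl
sumℤ-− (i ∷ l) f g = trans (cong (_+_ (f i - g i)) (sumℤ-− l f g))
                           (interchange (f i) (g i) (sumℤ l f) (sumℤ l g))
  where
  interchange : ∀ a b s t → (a - b) + (s - t) ≡ (a + s) - (b + t)
  interchange = solve-∀

sumℤ-*ˡ : ∀ l c (f : ℕ → ℤ) → sumℤ l (λ i → c * f i) ≡ c * sumℤ l f
sumℤ-*ˡ []      c f = sym (*-zeroʳ c)
sumℤ-*ˡ (i ∷ l) c f = trans (cong (_+_ (c * f i)) (sumℤ-*ˡ l c f)) (distrib c (f i) (sumℤ l f))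
  where
  distrib : ∀ c a s → c * a + c * s ≡ c * (a + s)
  distrib = solve-∀

module _ {f : ℕ → ℤ} where

  sumℤ-applyUpTo-cong : ∀ {g : ℕ → ℤ} (h : ℕ → ℕ) m → (∀ i → i < m → f (h i) ≡ g (h i)) →
                        sumℤ (applyUpTo h m) f ≡ sumℤ (applyUpTo h m) g
  sumℤ-applyUpTo-cong h zero    eq = refl
  sumℤ-applyUpTo-cong {g} h (suc m) eq =
    cong₂ _+_ (eq 0 (ℕ.s≤s ℕ.z≤n))
              (sumℤ-applyUpTo-cong {g} (h ∘ suc) m (λ i i<m → eq (suc i) (ℕ.s≤s i<m)))

  sumℤ-applyUpTo-zero : ∀ (h : ℕ → ℕ) m → (∀ i → f (h i) ≡ + 0) → sumℤ (applyUpTo h m) f ≡ + 0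
  sumℤ-applyUpTo-zero h zero    eq = refl
  sumℤ-applyUpTo-zero h (suc m) eq = cong₂ _+_ (eq 0) (sumℤ-applyUpTo-zero (h ∘ suc) m (eq ∘ suc))

  sumℤ-applyUpTo-+ : ∀ (h : ℕ → ℕ) m m′ →
                     sumℤ (applyUpTo h (m ℕ.+ m′)) f
                     ≡ sumℤ (applyUpTo h m) f + sumℤ (applyUpTo (h ∘ (m ℕ.+_)) m′) f
  sumℤ-applyUpTo-+ h zero    m′ = sym (+-identityˡ _)
  sumℤ-applyUpTo-+ h (suc m) m′ = trans (cong (_+_ (f (h 0))) (sumℤ-applyUpTo-+ (h ∘ suc) m m′))
                                  (sym (+-assoc (f (h 0)) (sumℤ (applyUpTo (h ∘ suc) m) f) _))

  sumℤ-applyUpTo-single : ∀ (h : ℕ → ℕ) m j → j < m → (∀ i → i ≢ j → f (h i) ≡ + 0) →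
                          sumℤ (applyUpTo h m) f ≡ f (h j)
  sumℤ-applyUpTo-single h (suc m) zero    _          eq =
    trans (cong (_+_ (f (h 0))) (sumℤ-applyUpTo-zero (h ∘ suc) m (λ i → eq (suc i) λ ()))) (+-identityʳ _)
  sumℤ-applyUpTo-single h (suc m) (suc j) (ℕ.s≤s j<m) eq =
    trans (cong₂ _+_ (eq 0 λ ())
                     (sumℤ-applyUpTo-single (h ∘ suc) m j j<m (λ i i≢j → eq (suc i) (i≢j ∘ ℕₚ.suc-injective))))
          (+-identityˡ _)

applyUpTo-cong : ∀ {A : Set} {f g : ℕ → A} → f ≗ g → ∀ m → applyUpTo f m ≡ applyUpTo g m
applyUpTo-cong {f = f} {g} f≗g m = trans (sym (map-upTo f m)) (trans (map-cong f≗g (upTo m)) (map-upTo g m))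

range-≤ : ∀ {a b} → a ≤ b → range a b ≡ a ∷ range (suc a) b
range-≤ {a} {b} a≤b = begin
  applyUpTo (a ℕ.+_) (suc b ∸ a)          ≡⟨ cong (applyUpTo (a ℕ.+_)) (ℕₚ.+-∸-assoc 1 a≤b) ⟩
  a ℕ.+ 0 ∷ applyUpTo (λ i → a ℕ.+ suc i) (b ∸ a)
    ≡⟨ cong₂ _∷_ (ℕₚ.+-identityʳ a) (applyUpTo-cong (ℕₚ.+-suc a) (b ∸ a)) ⟩
  a ∷ applyUpTo (suc a ℕ.+_) (b ∸ a)      ∎

range-> : ∀ {a b} → b < a → range a b ≡ []
range-> {a} b<a = cong (applyUpTo (a ℕ.+_)) (ℕₚ.m≤n⇒m∸n≡0 b<a)

module _ {n : ℕ} where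

  eval-sumP : ∀ (x : Fin n → ℤ) l (f : ℕ → Poly n) → eval x (sumP l f) ≡ sumℤ l (λ i → eval x (f i))
  eval-sumP x []      f = refl
  eval-sumP x (i ∷ l) f = cong (_+_ (eval x (f i))) (eval-sumP x l f)

  ∂-sumP : ∀ (k : Fin n) l (f : ℕ → Poly n) → ∂ k (sumP l f) ≡ sumP l (λ i → ∂ k (f i))
  ∂-sumP k []      f = refl
  ∂-sumP k (i ∷ l) f = cong (∂ k (f i) ⊕_) (∂-sumP k l f)

  module _ (k : Fin n) (x : Fin n → ℤ) where

    eval-∂-⊖ : ∀ p q → eval x (∂ k (p ⊖ q)) ≡ eval x (∂ k p) - eval x (∂ k q)
    eval-∂-⊖ p q = difference (eval x (∂ k p)) (eval x q) (eval x (∂ k q))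
      where
      difference : ∀ d e d′ → d + (+ 0 * e + - (+ 1) * d′) ≡ d - d′
      difference = solve-∀

    eval-∂-const⊗ : ∀ c p → eval x (∂ k (const c ⊗ p)) ≡ c * eval x (∂ k p)
    eval-∂-const⊗ c p = +-identityˡ (c * eval x (∂ k p))

    eval-∂-⊗-vanishing : ∀ p q → eval x p ≡ + 0 → eval x (∂ k (p ⊗ q)) ≡ eval x (∂ k p) * eval x q
    eval-∂-⊗-vanishing p q p≡0 =
      trans (cong (λ e → eval x (∂ k p) * eval x q + e * eval x (∂ k q)) p≡0) (+-identityʳ _)

  X-suc-toℕ : ∀ (k : Fin n) → X (suc (toℕ k)) ≡ var k
  X-suc-toℕ k with toℕ k <? n
  ... | yes k<n = cong var (fromℕ<-toℕ k k<n)
  ... | no  k≮n = ⊥-elim (k≮n (toℕ<n k))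

  ∂-var-self : ∀ (k : Fin n) → ∂ k (var k) ≡ one
  ∂-var-self k with k ≟ k
  ... | yes _   = refl
  ... | no  k≢k = ⊥-elim (k≢k refl)

  ∂-X-self : ∀ (k : Fin n) → ∂ k (X (suc (toℕ k))) ≡ one
  ∂-X-self k = trans (cong (∂ k) (X-suc-toℕ k)) (∂-var-self k)

  ∂-X-other : ∀ (k : Fin n) {i} → i ≢ suc (toℕ k) → ∂ k (X i) ≡ const (+ 0)
  ∂-X-other k {zero}  _ = refl
  ∂-X-other k {suc i} i≢k with i <? n
  ... | no  _   = refl
  ... | yes i<n with k ≟ fromℕ< i<n
  ...   | yes k≡i = ⊥-elim (i≢k (cong suc (trans (sym (toℕ-fromℕ< i<n)) (cong toℕ (sym k≡i)))))
  ...   | no  _   = refl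

  eval-pt-X⊖X² : ∀ (b : Fin n → Bool) i → eval (pt b) (X i ⊖ X i ⊗ X i) ≡ + 0
  eval-pt-X⊖X² b zero = refl
  eval-pt-X⊖X² b (suc i) with i <? n
  ... | yes i<n = bit (b (fromℕ< i<n))
    where
    bit : ∀ v → toℤ v + - (+ 1) * (toℤ v * toℤ v) ≡ + 0
    bit true  = refl
    bit false = refl
  ... | no  _   = refl

  α-unfold : ∀ {i} → i ≤ n → α n i ≡ X i ⊕ (one ⊖ two ⊗ X i) ⊗ α n (suc i)
  α-unfold {i} i≤n = begin
    αFrom (suc n ∸ i)      ≡⟨ cong αFrom (ℕₚ.+-∸-assoc 1 i≤n) ⟩
    αFrom (suc (n ∸ i))    ≡⟨ cong (λ j → X j ⊕ (one ⊖ two ⊗ X j) ⊗ αFrom (n ∸ i)) (ℕₚ.m∸[m∸n]≡n i≤n) ⟩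
    X i ⊕ (one ⊖ two ⊗ X i) ⊗ α n (suc i) ∎

  α-beyond : ∀ {i} → n < i → α n i ≡ const (+ 0)
  α-beyond n<i = cong αFrom (ℕₚ.m≤n⇒m∸n≡0 n<i)

module PartialDerivatives {n : ℕ} (k : Fin n) (x : Fin n → ℤ) where

  E D : Poly n → ℤ
  E = eval x
  D = eval x ∘ ∂ k

  K : ℕ
  K = suc (toℕ k)

  K≤n : K ≤ n
  K≤n = toℕ<n k

  σ : ℕ → ℤ
  σ j = + 1 - + 2 * E (X j)

  D-X-self : D (X K) ≡ + 1
  D-X-self = cong E (∂-X-self k)

  D-X-other : ∀ {i} → i ≢ K → D (X i) ≡ + 0
  D-X-other i≢K = cong E (∂-X-other k i≢K)

  ∂-α-step : ∀ i a → D (X i ⊕ (one ⊖ two ⊗ X i) ⊗ a) ≡ D (X i) * (+ 1 - + 2 * E a) + σ i * D a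
  ∂-α-step i a = product-rule (D (X i)) (E (X i)) (E a) (D a)
    where
    product-rule : ∀ d e a d′ →
                   d + ((+ 0 + (+ 0 * (+ 2 * e) + - (+ 1) * (+ 0 * e + + 2 * d))) * a + (+ 1 + - (+ 1) * (+ 2 * e)) * d′)
                   ≡ d * (+ 1 - + 2 * a) + (+ 1 - + 2 * e) * d′
    product-rule = solve-∀

  ∂α-rec : ∀ {i} → i ≤ n → D (α n i) ≡ D (X i) * (+ 1 - + 2 * E (α n (suc i))) + σ i * D (α n (suc i))
  ∂α-rec {i} i≤n = trans (cong D (α-unfold i≤n)) (∂-α-step i (α n (suc i)))

  -- αFrom m only involves the variables x_{n+1-m}, …, x_n.
  ∂αFrom-vanishes : ∀ m → K ℕ.+ m ≤ n → D (αFrom m) ≡ + 0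
  ∂αFrom-vanishes zero    _  = refl
  ∂αFrom-vanishes (suc m) le = begin
    D (αFrom (suc m))
      ≡⟨ ∂-α-step (n ∸ m) (αFrom m) ⟩
    D (X (n ∸ m)) * (+ 1 - + 2 * E (αFrom m)) + σ (n ∸ m) * D (αFrom m)
      ≡⟨ cong₂ (λ d d′ → d * (+ 1 - + 2 * E (αFrom m)) + σ (n ∸ m) * d′)
               (D-X-other (ℕₚ.>⇒≢ K<n∸m))
               (∂αFrom-vanishes m (ℕₚ.≤-trans (ℕₚ.+-monoʳ-≤ K (ℕₚ.n≤1+n m)) le)) ⟩
    + 0 + σ (n ∸ m) * + 0
      ≡⟨ trans (+-identityˡ (σ (n ∸ m) * + 0)) (*-zeroʳ (σ (n ∸ m))) ⟩
    + 0 ∎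
    where
    K<n∸m : K < n ∸ m
    K<n∸m = ℕₚ.m+n≤o⇒m≤o∸n (suc K) (ℕₚ.≤-trans (ℕₚ.≤-reflexive (sym (ℕₚ.+-suc K m))) le)

  ∂α-above : ∀ {i} → K < i → D (α n i) ≡ + 0
  ∂α-above {i} K<i = ∂αFrom-vanishes (suc n ∸ i)
    (ℕₚ.≤-trans (ℕₚ.+-monoʳ-≤ K (ℕₚ.∸-monoʳ-≤ (suc n) K<i)) (ℕₚ.≤-reflexive (ℕₚ.m+[n∸m]≡n K≤n)))

  γ : ℤ
  γ = + 1 - + 2 * E (α n (suc K))

  ∏σ : ℕ → ℤ
  ∏σ i = prodℤ (range i (K ∸ 1)) σ

  ∂α-below : ∀ {i} → i ≤ K → D (α n i) ≡ γ * ∏σ i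
  ∂α-below {i} i≤K = climb (K ∸ i) (ℕₚ.m∸n+n≡m i≤K)
    where
    climb : ∀ g {i} → g ℕ.+ i ≡ K → D (α n i) ≡ γ * ∏σ i
    climb zero refl = begin
      D (α n K)
        ≡⟨ ∂α-rec K≤n ⟩
      D (X K) * γ + σ K * D (α n (suc K))
        ≡⟨ cong₂ (λ d d′ → d * γ + σ K * d′) D-X-self (∂α-above (ℕₚ.n<1+n K)) ⟩
      + 1 * γ + σ K * + 0
        ≡⟨ base γ (σ K) ⟩
      γ * + 1
        ≡⟨ cong (λ l → γ * prodℤ l σ) (sym (range-> (ℕₚ.n<1+n (toℕ k)))) ⟩
      γ * ∏σ K ∎
      where
      base : ∀ c s → + 1 * c + s * + 0 ≡ c * + 1
      base = solve-∀
    climb (suc g) {i} g+i≡K = begin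
      D (α n i)
        ≡⟨ ∂α-rec (ℕₚ.≤-trans (ℕₚ.<⇒≤ i<K) K≤n) ⟩
      D (X i) * (+ 1 - + 2 * E (α n (suc i))) + σ i * D (α n (suc i))
        ≡⟨ cong₂ (λ d d′ → d * (+ 1 - + 2 * E (α n (suc i))) + σ i * d′)
                 (D-X-other (ℕₚ.<⇒≢ i<K))
                 (climb g (trans (ℕₚ.+-suc g i) g+i≡K)) ⟩
      + 0 + σ i * (γ * ∏σ (suc i))
        ≡⟨ step (σ i) γ (∏σ (suc i)) ⟩
      γ * (σ i * ∏σ (suc i))
        ≡⟨ cong (λ l → γ * prodℤ l σ) (sym (range-≤ (ℕₚ.≤-pred i<K))) ⟩
      γ * ∏σ i ∎
      where
      i<K : i < K
      i<K = ℕₚ.≤-trans (ℕ.s≤s (ℕₚ.m≤n+m i g)) (ℕₚ.≤-reflexive g+i≡K)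
      step : ∀ s c p → + 0 + s * (c * p) ≡ c * (s * p)
      step = solve-∀

  sum-∂α : sumℤ (range 1 n) (λ i → + (2 ^ (i ∸ 1)) * D (α n i))
           ≡ γ * sumℤ (range 1 K) (λ i → + (2 ^ (i ∸ 1)) * ∏σ i)
  sum-∂α = begin
    sumℤ (applyUpTo suc n) w
      ≡⟨ cong (λ m → sumℤ (applyUpTo suc m) w) (sym (ℕₚ.m+[n∸m]≡n K≤n)) ⟩
    sumℤ (applyUpTo suc (K ℕ.+ (n ∸ K))) w
      ≡⟨ sumℤ-applyUpTo-+ {f = w} suc K (n ∸ K) ⟩
    sumℤ (applyUpTo suc K) w + sumℤ (applyUpTo (suc ∘ (K ℕ.+_)) (n ∸ K)) w
      ≡⟨ cong₂ _+_ (sumℤ-applyUpTo-cong {f = w} {g = w′} suc K below)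
                   (sumℤ-applyUpTo-zero {f = w} (suc ∘ (K ℕ.+_)) (n ∸ K) above) ⟩
    sumℤ (range 1 K) w′ + + 0
      ≡⟨ +-identityʳ _ ⟩
    sumℤ (range 1 K) w′
      ≡⟨ sumℤ-cong (range 1 K) (λ i → x∙yz≈y∙xz (+ (2 ^ (i ∸ 1))) γ (∏σ i)) ⟩
    sumℤ (range 1 K) (λ i → γ * (+ (2 ^ (i ∸ 1)) * ∏σ i))
      ≡⟨ sumℤ-*ˡ (range 1 K) γ (λ i → + (2 ^ (i ∸ 1)) * ∏σ i) ⟩
    γ * sumℤ (range 1 K) (λ i → + (2 ^ (i ∸ 1)) * ∏σ i) ∎
    where
    w : ℕ → ℤ
    w i = + (2 ^ (i ∸ 1)) * D (α n i)
    w′ : ℕ → ℤ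
    w′ i = + (2 ^ (i ∸ 1)) * (γ * ∏σ i)
    below : ∀ j → j < K → w (suc j) ≡ w′ (suc j)
    below j j<K = cong (_*_ (+ (2 ^ j))) (∂α-below j<K)
    above : ∀ j → w (suc (K ℕ.+ j)) ≡ + 0
    above j = trans (cong (_*_ (+ (2 ^ (K ℕ.+ j)))) (∂α-above (ℕ.s≤s (ℕₚ.m≤m+n K j))))
                    (*-zeroʳ (+ (2 ^ (K ℕ.+ j))))

  ∂ᵢβ : ℕ → ℤ
  ∂ᵢβ i = + (2 ^ i) * σ i * ((+ 1 - E (X (i ∸ 1))) + sumℤ (range 1 (i ∸ 2)) (E ∘ X))

  module _ (cube : ∀ i → E (X i ⊖ X i ⊗ X i) ≡ + 0) where

    ∂β : ∀ i → D (β n i) ≡ D (X i) * ∂ᵢβ i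
    ∂β i = begin
      D (β n i)
        ≡⟨ eval-∂-⊗-vanishing k x (pow2 i ⊗ (X i ⊖ X i ⊗ X i)) S
             (trans (cong (_*_ (+ (2 ^ i))) (cube i)) (*-zeroʳ (+ (2 ^ i)))) ⟩
      D (pow2 i ⊗ (X i ⊖ X i ⊗ X i)) * E S
        ≡⟨ cong (λ z → D (pow2 i ⊗ (X i ⊖ X i ⊗ X i)) * ((+ 1 + - (+ 1) * E (X (i ∸ 1))) + z))
                (eval-sumP x (range 1 (i ∸ 2)) X) ⟩
      D (pow2 i ⊗ (X i ⊖ X i ⊗ X i)) * ((+ 1 + - (+ 1) * E (X (i ∸ 1))) + Σx)
        ≡⟨ product-rule (+ (2 ^ i)) (D (X i)) (E (X i)) (E (X (i ∸ 1))) Σx ⟩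
      D (X i) * ∂ᵢβ i ∎
      where
      S : Poly n
      S = (one ⊖ X (i ∸ 1)) ⊕ sumP (range 1 (i ∸ 2)) X
      Σx : ℤ
      Σx = sumℤ (range 1 (i ∸ 2)) (E ∘ X)
      product-rule : ∀ p d e y z →
                     (+ 0 + p * (d + (+ 0 + - (+ 1) * (d * e + e * d)))) * ((+ 1 + - (+ 1) * y) + z)
                     ≡ d * (p * (+ 1 - + 2 * e) * ((+ 1 - y) + z))
      product-rule = solve-∀

    sum-∂β : sumℤ (range 1 n) (D ∘ β n) ≡ ∂ᵢβ K
    sum-∂β = begin
      sumℤ (applyUpTo suc n) (D ∘ β n)
        ≡⟨ sumℤ-applyUpTo-single {f = D ∘ β n} suc n (toℕ k) K≤n
             (λ i i≢k → trans (∂β (suc i)) (cong (_* ∂ᵢβ (suc i)) (D-X-other (i≢k ∘ ℕₚ.suc-injective)))) ⟩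
      D (β n K)
        ≡⟨ ∂β K ⟩
      D (X K) * ∂ᵢβ K
        ≡⟨ trans (cong (_* ∂ᵢβ K) D-X-self) (*-identityˡ (∂ᵢβ K)) ⟩
      ∂ᵢβ K ∎

lemma2 : (n : ℕ) (k : Fin n) (x : Fin n → Bool) →
    eval (pt x) (∂ k (F n)) ≡ rhs n x (suc (toℕ k))
lemma2 n k b = begin
  D (F n)
    ≡⟨ trans (cong E (∂-sumP k (range 1 n) summand)) (eval-sumP (pt b) (range 1 n) (∂ k ∘ summand)) ⟩
  sumℤ (range 1 n) (D ∘ summand)
    ≡⟨ sumℤ-cong (range 1 n) ∂-summand ⟩
  sumℤ (range 1 n) (λ i → + (2 ^ (i ∸ 1)) * D (α n i) - D (β n i))
    ≡⟨ sumℤ-− (range 1 n) (λ i → + (2 ^ (i ∸ 1)) * D (α n i)) (D ∘ β n) ⟩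
  sumℤ (range 1 n) (λ i → + (2 ^ (i ∸ 1)) * D (α n i)) - sumℤ (range 1 n) (D ∘ β n)
    ≡⟨ cong₂ _-_ sum-∂α (sum-∂β (eval-pt-X⊖X² b)) ⟩
  γ * sumℤ (range 1 K) (λ i → + (2 ^ (i ∸ 1)) * ∏σ i) - ∂ᵢβ K ∎
  where
  open PartialDerivatives k (pt b)

  summand : ℕ → Poly n
  summand i = pow2 (i ∸ 1) ⊗ α n i ⊖ β n i

  ∂-summand : ∀ i → D (summand i) ≡ + (2 ^ (i ∸ 1)) * D (α n i) - D (β n i)
  ∂-summand i = trans (eval-∂-⊖ k (pt b) (pow2 (i ∸ 1) ⊗ α n i) (β n i))
                      (cong (_- D (β n i)) (eval-∂-const⊗ k (pt b) (+ (2 ^ (i ∸ 1))) (α n i)))
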